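{- Let $n\ge2$, $N=p_1\cdots p_n$ a product of distinct primes, and let $S$ be a set of ordered pairs such that for all $1\le i\ne j\le n$, $S$ contains exactly one of $(i,j)$ and $(j,i)$. Then modulo $1-x^N$, $P_N(x)$ is congruent to the polynomial $$\sum_{i=1}^n\Biggl(\frac{1-x^N}{1-x^{N_i}}\prod_{(i,j)\in S}\frac{1-x^{\langle p_i^{ -1}\rangle_{p_j}N_j}}{1-x^{N_j}}\prod_{(j,i)\in S}\frac{x^N-x^{\langle p_i^{ -1}\rangle_{p_j}N_j}}{1-x^{N_j}}\prod_{\substack{1\le j_1<j_2\le n\\ j_1,j_2\ne i}}\bigl(1-x^{N_{j_1j_2}}\bigr)\Biggr).$$
   Context: For indices $i_1,\dots,i_m\in[n]$ write $N_{i_1\cdots i_m}=N/(p_{i_1}\cdots p_{i_m})$, and $$P_N(x)=\frac{(1-x^N)\prod_{1\le i<j\le n}(1-x^{N_{ij}})}{\prod_{i=1}^n(1-x^{N_i})}.$$ For a rational number $c=a/b$ with $b$ coprime to $m$, $\langle c\rangle_m$ denotes the smallest nonnegative integer $k$ with $kb\equiv a\pmod m$. -}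

module Defs where

open import Data.Bool using (Bool; true; false; if_then_else_; _∧_; not)
open import Data.Nat as ℕ using (ℕ; zero; suc)
open import Data.Nat.DivMod using (_/_; _%_)
open import Data.Fin using (Fin; toℕ)
open import Data.Fin.Properties using () renaming (_≟_ to _≟ᶠ_)
open import Data.Integer as ℤ using (ℤ; +_)
open import Data.List using (List; []; _∷_; replicate; _++_; foldr; map; allFin; concatMap)
open import Relation.Binary.PropositionalEquality using (_≡_)
open import Relation.Nullary using (does)

-- Polynomials with integer coefficients, as coefficient lists
-- (constant term first).  Equality is coefficientwise (_≈ₚ_), so
-- trailing zeros do not matter.

Poly : Set
Poly = List ℤ

coeff : Poly → ℕ → ℤ
coeff []       _       = + 0
coeff (a ∷ _)  zero    = a
coeff (_ ∷ as) (suc k) = coeff as k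

_≈ₚ_ : Poly → Poly → Set
p ≈ₚ q = ∀ k → coeff p k ≡ coeff q k

infix 4 _≈ₚ_
infixl 6 _⊕_
infixl 7 _⊗_

_⊕_ : Poly → Poly → Poly
[]       ⊕ q        = q
p        ⊕ []       = p
(a ∷ as) ⊕ (b ∷ bs) = (a ℤ.+ b) ∷ (as ⊕ bs)

negP : Poly → Poly
negP = map (λ a → ℤ.- a)

scale : ℤ → Poly → Poly
scale c = map (c ℤ.*_)

_⊗_ : Poly → Poly → Poly
[]       ⊗ q = []
(a ∷ as) ⊗ q = scale a q ⊕ (+ 0 ∷ (as ⊗ q))

oneP : Poly
oneP = + 1 ∷ []

X^ : ℕ → Poly
X^ k = replicate k (+ 0) ++ (+ 1 ∷ [])

1-X^ : ℕ → Poly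
1-X^ k = oneP ⊕ negP (X^ k)

prodP : List Poly → Poly
prodP = foldr _⊗_ oneP

sumP : List Poly → Poly
sumP = foldr _⊕_ []

-- truncated division (a / 0 := 0; never used with divisor 0 here)
quot : ℕ → ℕ → ℕ
quot a zero    = 0
quot a (suc b) = a / suc b

-- ⟨ 1 / b ⟩_m : the smallest nonnegative integer k with k * b ≡ 1 (mod m),
-- found by searching k = 0, 1, …, m-1 (returns 0 if none exists, which
-- does not happen when gcd(b, m) = 1).
invMod : ℕ → ℕ → ℕ
invMod b zero    = 0
invMod b (suc m') = go 0 (suc m')
  where
  go : ℕ → ℕ → ℕ
  go k zero     = 0
  go k (suc f)  = if ((k ℕ.* b) % suc m') ℕ.≡ᵇ (1 % suc m') then k else go (suc k) f

-- Data of the theorem, for n primes p : Fin n → ℕ (indices 0..n-1)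

module _ {n : ℕ} (p : Fin n → ℕ) where

  prodN : List (Fin n) → ℕ
  prodN = foldr (λ i r → p i ℕ.* r) 1

  NN : ℕ
  NN = prodN (allFin n)

  N₁ : Fin n → ℕ
  N₁ i = quot NN (p i)

  N₂ : Fin n → Fin n → ℕ
  N₂ i j = quot NN (p i ℕ.* p j)

  pairsProd : (Fin n → Bool) → Poly
  pairsProd allowed =
    prodP (concatMap (λ j₁ → concatMap (λ j₂ →
      if (allowed j₁ ∧ allowed j₂ ∧ (toℕ j₁ ℕ.<ᵇ toℕ j₂))
      then 1-X^ (N₂ j₁ j₂) ∷ [] else []) (allFin n)) (allFin n))

  -- numerator of P_N : (1 - x^N) ∏_{i<j} (1 - x^{N_ij})
  numP : Poly
  numP = 1-X^ NN ⊗ pairsProd (λ _ → true)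

  -- denominator of P_N : ∏_i (1 - x^{N_i})
  denP : Poly
  denP = prodP (map (λ i → 1-X^ (N₁ i)) (allFin n))

  neq : Fin n → Fin n → Bool
  neq i j = not (does (i ≟ᶠ j))

  -- the i-th summand of the right-hand side, multiplied by the common
  -- denominator ∏_k (1 - x^{N_k}), i.e.
  --  (1 - x^N) ∏_{(i,j)∈S} (1 - x^{⟨p_i⁻¹⟩_{p_j} N_j})
  --            ∏_{(j,i)∈S} (x^N - x^{⟨p_i⁻¹⟩_{p_j} N_j})
  --            ∏_{j₁<j₂, j₁,j₂ ≠ i} (1 - x^{N_{j₁j₂}})
  termA : (S : Fin n → Fin n → Bool) → Fin n → Poly
  termA S i =
    1-X^ NN
    ⊗ prodP (concatMap (λ j →
        if (neq i j ∧ S i j)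
        then 1-X^ (invMod (p i) (p j) ℕ.* N₁ j) ∷ [] else []) (allFin n))
    ⊗ prodP (concatMap (λ j →
        if (neq i j ∧ S j i)
        then (X^ NN ⊕ negP (X^ (invMod (p i) (p j) ℕ.* N₁ j))) ∷ [] else []) (allFin n))
    ⊗ pairsProd (neq i)

  -- Σ_i termA S i  =  (right-hand side of the theorem) · ∏_k (1 - x^{N_k})
  rhsTimesDen : (Fin n → Fin n → Bool) → Poly
  rhsTimesDen S = sumP (map (termA S) (allFin n))

{-# OPTIONS --safe #-}
module Submission where

-- Write d_j = 1 - x^{N_j}, E_{ij} = 1 - x^{N_{ij}}, and let F_{ij} be the factor of the i-th summand
-- attached to j ≠ i: 1 - x^{c N_j} if (i,j) ∈ S and x^N - x^{c N_j} if (j,i) ∈ S, where c = ⟨p_i⁻¹⟩_{p_j}.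
-- After cancelling the common factor 1 - x^N and clearing the denominator ∏ d_j, the claim reads
--   ∏_{i<j} E_{ij} ≡ Σ_i ∏_{j≠i} F_{ij} ∏_{j₁<j₂; j₁,j₂≠i} E_{j₁j₂}   (mod ∏_j d_j).
-- Two facts drive it: d_j divides F_{ij}, and E_{ij} ≡ F_{ij} + F_{ji} modulo d_i d_j, which comes from
-- c p_i + c′ p_j = 1 + p_i p_j for the two modular inverses.  Expanding ∏_{i<j} (F_{ij} + F_{ji}) over
-- orientations of the complete graph, every orientation in which each vertex has an in-neighbour gives a
-- multiple of ∏ d_j, and the orientations with a source i give the i-th summand.

open import Defs
open import Algebra.Bundles using (CommutativeRing)
open import Algebra.Structures using (IsCommutativeRing)
open import Data.Bool using (Bool; true; false; not; if_then_else_; _∧_)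
open import Data.Bool.Properties using (∧-zeroʳ; ∧-identityʳ)
open import Data.Fin using (Fin; zero; suc; toℕ)
open import Data.Fin.Properties using (suc-injective) renaming (_≟_ to _≟ᶠ_)
import Data.Integer.Properties as ℤ
open import Data.List using (List; []; _∷_; _++_; map; concatMap; tabulate; allFin)
open import Data.Nat using (ℕ; zero; suc; _≤_; _<_; _<ᵇ_; s≤s; z≤n)
open import Data.Nat.Primality using (Prime)
open import Data.Product using (_×_; _,_; ∃; proj₁; proj₂)
open import Data.Sum using (_⊎_; inj₁; inj₂)
open import Function using (_∘_; id)
open import Level using (0ℓ; _⊔_)
open import Relation.Binary.Bundles using (Setoid)
open import Relation.Binary.PropositionalEquality
  using (_≡_; _≢_; refl; sym; trans; cong; cong₂; subst; subst₂; module ≡-Reasoning)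
import Relation.Binary.Reasoning.Setoid
open import Relation.Nullary using (does; yes; no)

-- The ring ℤ[x]

module PolynomialRing where
  open import Data.Integer using (0ℤ; 1ℤ; _+_; _*_; -_)
  open import Data.Integer.Tactic.RingSolver using (solve-∀)
  open ≡-Reasoning

  -- A record rather than _≈ₚ_ itself, so that the polynomials can be inferred from proofs.
  infix 4 _≃_
  record _≃_ (p q : Poly) : Set where
    constructor coeffwise
    field coeff-≡ : p ≈ₚ q
  open _≃_ public

  ≃-refl : ∀ {p} → p ≃ p
  ≃-refl = coeffwise λ _ → refl

  ≃-sym : ∀ {p q} → p ≃ q → q ≃ p
  ≃-sym e = coeffwise λ k → sym (coeff-≡ e k)

  ≃-trans : ∀ {p q r} → p ≃ q → q ≃ r → p ≃ r
  ≃-trans e f = coeffwise λ k → trans (coeff-≡ e k) (coeff-≡ f k)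

  ∷-cong : ∀ {a b p q} → a ≡ b → p ≃ q → a ∷ p ≃ b ∷ q
  ∷-cong a≡b p≃q = coeffwise λ { zero → a≡b ; (suc k) → coeff-≡ p≃q k }

  ∷-injectiveʳ : ∀ {a b p q} → a ∷ p ≃ b ∷ q → p ≃ q
  ∷-injectiveʳ e = coeffwise λ k → coeff-≡ e (suc k)

  0∷-≃[] : ∀ {p} → p ≃ [] → 0ℤ ∷ p ≃ []
  0∷-≃[] p≃[] = coeffwise λ { zero → refl ; (suc k) → coeff-≡ p≃[] k }

  coeff-⊕ : ∀ p q k → coeff (p ⊕ q) k ≡ coeff p k + coeff q k
  coeff-⊕ []       q        k       = sym (ℤ.+-identityˡ _)
  coeff-⊕ (a ∷ as) []       k       = sym (ℤ.+-identityʳ _)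
  coeff-⊕ (a ∷ as) (b ∷ bs) zero    = refl
  coeff-⊕ (a ∷ as) (b ∷ bs) (suc k) = coeff-⊕ as bs k

  coeff-negP : ∀ p k → coeff (negP p) k ≡ - coeff p k
  coeff-negP []       k       = refl
  coeff-negP (a ∷ as) zero    = refl
  coeff-negP (a ∷ as) (suc k) = coeff-negP as k

  coeff-scale : ∀ c p k → coeff (scale c p) k ≡ c * coeff p k
  coeff-scale c []       k       = sym (ℤ.*-zeroʳ c)
  coeff-scale c (a ∷ as) zero    = refl
  coeff-scale c (a ∷ as) (suc k) = coeff-scale c as k

  ⊕-cong : ∀ {p p′ q q′} → p ≃ p′ → q ≃ q′ → p ⊕ q ≃ p′ ⊕ q′
  ⊕-cong {p} {p′} {q} {q′} e f = coeffwise λ k → begin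
    coeff (p ⊕ q) k           ≡⟨ coeff-⊕ p q k ⟩
    coeff p k + coeff q k     ≡⟨ cong₂ _+_ (coeff-≡ e k) (coeff-≡ f k) ⟩
    coeff p′ k + coeff q′ k   ≡⟨ coeff-⊕ p′ q′ k ⟨
    coeff (p′ ⊕ q′) k         ∎

  negP-cong : ∀ {p q} → p ≃ q → negP p ≃ negP q
  negP-cong {p} {q} e = coeffwise λ k →
    trans (coeff-negP p k) (trans (cong -_ (coeff-≡ e k)) (sym (coeff-negP q k)))

  scale-cong : ∀ c {p q} → p ≃ q → scale c p ≃ scale c q
  scale-cong c {p} {q} e = coeffwise λ k →
    trans (coeff-scale c p k) (trans (cong (c *_) (coeff-≡ e k)) (sym (coeff-scale c q k)))

  ⊕-assoc : ∀ p q r → (p ⊕ q) ⊕ r ≃ p ⊕ (q ⊕ r)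
  ⊕-assoc p q r = coeffwise λ k → begin
    coeff ((p ⊕ q) ⊕ r) k                  ≡⟨ coeff-⊕ (p ⊕ q) r k ⟩
    coeff (p ⊕ q) k + coeff r k            ≡⟨ cong (_+ coeff r k) (coeff-⊕ p q k) ⟩
    (coeff p k + coeff q k) + coeff r k    ≡⟨ ℤ.+-assoc (coeff p k) _ _ ⟩
    coeff p k + (coeff q k + coeff r k)    ≡⟨ cong (coeff p k +_) (coeff-⊕ q r k) ⟨
    coeff p k + coeff (q ⊕ r) k            ≡⟨ coeff-⊕ p (q ⊕ r) k ⟨
    coeff (p ⊕ (q ⊕ r)) k                  ∎

  ⊕-comm : ∀ p q → p ⊕ q ≃ q ⊕ p
  ⊕-comm p q = coeffwise λ k →
    trans (coeff-⊕ p q k) (trans (ℤ.+-comm (coeff p k) _) (sym (coeff-⊕ q p k)))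

  ⊕-identityˡ : ∀ p → [] ⊕ p ≃ p
  ⊕-identityˡ p = ≃-refl

  ⊕-identityʳ : ∀ p → p ⊕ [] ≃ p
  ⊕-identityʳ p = coeffwise λ k → trans (coeff-⊕ p [] k) (ℤ.+-identityʳ _)

  ⊕-inverseˡ : ∀ p → negP p ⊕ p ≃ []
  ⊕-inverseˡ p = coeffwise λ k → trans (coeff-⊕ (negP p) p k)
    (trans (cong (_+ coeff p k) (coeff-negP p k)) (ℤ.+-inverseˡ (coeff p k)))

  ⊕-inverseʳ : ∀ p → p ⊕ negP p ≃ []
  ⊕-inverseʳ p = ≃-trans (⊕-comm p (negP p)) (⊕-inverseˡ p)

  scale-0 : ∀ p → scale 0ℤ p ≃ []
  scale-0 p = coeffwise (coeff-scale 0ℤ p)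

  scale-1 : ∀ p → scale 1ℤ p ≃ p
  scale-1 p = coeffwise λ k → trans (coeff-scale 1ℤ p k) (ℤ.*-identityˡ _)

  scale-distrib-⊕ : ∀ c p q → scale c (p ⊕ q) ≃ scale c p ⊕ scale c q
  scale-distrib-⊕ c p q = coeffwise λ k → begin
    coeff (scale c (p ⊕ q)) k                    ≡⟨ coeff-scale c (p ⊕ q) k ⟩
    c * coeff (p ⊕ q) k                          ≡⟨ cong (c *_) (coeff-⊕ p q k) ⟩
    c * (coeff p k + coeff q k)                  ≡⟨ ℤ.*-distribˡ-+ c (coeff p k) _ ⟩
    c * coeff p k + c * coeff q k                ≡⟨ cong₂ _+_ (coeff-scale c p k) (coeff-scale c q k) ⟨
    coeff (scale c p) k + coeff (scale c q) k    ≡⟨ coeff-⊕ (scale c p) (scale c q) k ⟨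
    coeff (scale c p ⊕ scale c q) k              ∎

  scale-distrib-+ : ∀ a b p → scale (a + b) p ≃ scale a p ⊕ scale b p
  scale-distrib-+ a b p = coeffwise λ k → begin
    coeff (scale (a + b) p) k                    ≡⟨ coeff-scale (a + b) p k ⟩
    (a + b) * coeff p k                          ≡⟨ ℤ.*-distribʳ-+ (coeff p k) a b ⟩
    a * coeff p k + b * coeff p k                ≡⟨ cong₂ _+_ (coeff-scale a p k) (coeff-scale b p k) ⟨
    coeff (scale a p) k + coeff (scale b p) k    ≡⟨ coeff-⊕ (scale a p) (scale b p) k ⟨
    coeff (scale a p ⊕ scale b p) k              ∎

  scale-scale : ∀ a b p → scale a (scale b p) ≃ scale (a * b) p
  scale-scale a b p = coeffwise λ k → begin
    coeff (scale a (scale b p)) k    ≡⟨ coeff-scale a (scale b p) k ⟩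
    a * coeff (scale b p) k          ≡⟨ cong (a *_) (coeff-scale b p k) ⟩
    a * (b * coeff p k)              ≡⟨ ℤ.*-assoc a b _ ⟨
    a * b * coeff p k                ≡⟨ coeff-scale (a * b) p k ⟨
    coeff (scale (a * b) p) k        ∎

  ⊗-zeroʳ : ∀ p → p ⊗ [] ≃ []
  ⊗-zeroʳ []       = ≃-refl
  ⊗-zeroʳ (a ∷ as) = 0∷-≃[] (⊗-zeroʳ as)

  ⊗-zeroˡ-≃ : ∀ p q → p ≃ [] → p ⊗ q ≃ []
  ⊗-zeroˡ-≃ []       q e = ≃-refl
  ⊗-zeroˡ-≃ (a ∷ as) q e =
    ⊕-cong (≃-trans (scale-cong′ (coeff-≡ e zero)) (scale-0 q))
           (0∷-≃[] (⊗-zeroˡ-≃ as q (coeffwise λ k → coeff-≡ e (suc k))))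
    where
    scale-cong′ : ∀ {a b} → a ≡ b → scale a q ≃ scale b q
    scale-cong′ refl = ≃-refl

  ⊗-congʳ : ∀ {p p′} q → p ≃ p′ → p ⊗ q ≃ p′ ⊗ q
  ⊗-congʳ {[]}     {p′}     q e = ≃-sym (⊗-zeroˡ-≃ p′ q (≃-sym e))
  ⊗-congʳ {a ∷ as} {[]}     q e = ⊗-zeroˡ-≃ (a ∷ as) q e
  ⊗-congʳ {a ∷ as} {b ∷ bs} q e with coeff-≡ e zero
  ... | refl = ⊕-cong (≃-refl {scale a q}) (∷-cong refl (⊗-congʳ q (∷-injectiveʳ e)))

  ⊗-congˡ : ∀ p {q q′} → q ≃ q′ → p ⊗ q ≃ p ⊗ q′
  ⊗-congˡ []       e = ≃-refl
  ⊗-congˡ (a ∷ as) e = ⊕-cong (scale-cong a e) (∷-cong refl (⊗-congˡ as e))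

  ⊗-cong : ∀ {p p′ q q′} → p ≃ p′ → q ≃ q′ → p ⊗ q ≃ p′ ⊗ q′
  ⊗-cong {p′ = p′} {q} e f = ≃-trans (⊗-congʳ q e) (⊗-congˡ p′ f)

  ⊗-distribʳ : ∀ r p q → (p ⊕ q) ⊗ r ≃ p ⊗ r ⊕ q ⊗ r
  ⊗-distribʳ r []       q        = ≃-refl
  ⊗-distribʳ r (a ∷ as) []       = ≃-sym (⊕-identityʳ _)
  ⊗-distribʳ r (a ∷ as) (b ∷ bs) = coeffwise λ k → begin
    coeff (scale (a + b) r ⊕ (0ℤ ∷ (as ⊕ bs) ⊗ r)) k
      ≡⟨ coeff-≡ (⊕-cong (scale-distrib-+ a b r) (∷-cong refl (⊗-distribʳ r as bs))) k ⟩
    coeff ((sa ⊕ sb) ⊕ (ta ⊕ tb)) k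
      ≡⟨ coeff-⊕ (sa ⊕ sb) (ta ⊕ tb) k ⟩
    coeff (sa ⊕ sb) k + coeff (ta ⊕ tb) k
      ≡⟨ cong₂ _+_ (coeff-⊕ sa sb k) (coeff-⊕ ta tb k) ⟩
    (coeff sa k + coeff sb k) + (coeff ta k + coeff tb k)
      ≡⟨ interchange (coeff sa k) (coeff sb k) (coeff ta k) (coeff tb k) ⟩
    (coeff sa k + coeff ta k) + (coeff sb k + coeff tb k)
      ≡⟨ cong₂ _+_ (coeff-⊕ sa ta k) (coeff-⊕ sb tb k) ⟨
    coeff (sa ⊕ ta) k + coeff (sb ⊕ tb) k
      ≡⟨ coeff-⊕ (sa ⊕ ta) (sb ⊕ tb) k ⟨
    coeff ((a ∷ as) ⊗ r ⊕ (b ∷ bs) ⊗ r) k ∎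
    where
    sa = scale a r
    sb = scale b r
    ta = 0ℤ ∷ as ⊗ r
    tb = 0ℤ ∷ bs ⊗ r
    interchange : ∀ w x y z → (w + x) + (y + z) ≡ (w + y) + (x + z)
    interchange = solve-∀

  scale-⊗ : ∀ c p q → scale c p ⊗ q ≃ scale c (p ⊗ q)
  scale-⊗ c []       q = ≃-refl
  scale-⊗ c (a ∷ as) q =
    ≃-trans (⊕-cong (≃-sym (scale-scale c a q)) (∷-cong (sym (ℤ.*-zeroʳ c)) (scale-⊗ c as q)))
            (≃-sym (scale-distrib-⊕ c (scale a q) (0ℤ ∷ as ⊗ q)))

  0∷-⊗ : ∀ p q → (0ℤ ∷ p) ⊗ q ≃ 0ℤ ∷ p ⊗ q
  0∷-⊗ p q = ⊕-cong (scale-0 q) ≃-refl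

  ⊗-∷ : ∀ p b q → p ⊗ (b ∷ q) ≃ scale b p ⊕ (0ℤ ∷ p ⊗ q)
  ⊗-∷ []       b q = ≃-sym (0∷-≃[] ≃-refl)
  ⊗-∷ (a ∷ as) b q = coeffwise λ
    { zero → trans (ℤ.+-identityʳ _) (trans (ℤ.*-comm a b) (sym (ℤ.+-identityʳ _)))
    ; (suc k) → begin
        coeff (scale a q ⊕ as ⊗ (b ∷ q)) k
          ≡⟨ coeff-⊕ (scale a q) _ k ⟩
        coeff (scale a q) k + coeff (as ⊗ (b ∷ q)) k
          ≡⟨ cong (coeff (scale a q) k +_) (coeff-≡ (⊗-∷ as b q) k) ⟩
        coeff (scale a q) k + coeff (scale b as ⊕ (0ℤ ∷ as ⊗ q)) k
          ≡⟨ cong (coeff (scale a q) k +_) (coeff-⊕ (scale b as) _ k) ⟩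
        coeff (scale a q) k + (coeff (scale b as) k + coeff (0ℤ ∷ as ⊗ q) k)
          ≡⟨ ℤ.+-assoc (coeff (scale a q) k) _ _ ⟨
        (coeff (scale a q) k + coeff (scale b as) k) + coeff (0ℤ ∷ as ⊗ q) k
          ≡⟨ cong (_+ coeff (0ℤ ∷ as ⊗ q) k) (ℤ.+-comm (coeff (scale a q) k) _) ⟩
        (coeff (scale b as) k + coeff (scale a q) k) + coeff (0ℤ ∷ as ⊗ q) k
          ≡⟨ ℤ.+-assoc (coeff (scale b as) k) _ _ ⟩
        coeff (scale b as) k + (coeff (scale a q) k + coeff (0ℤ ∷ as ⊗ q) k)
          ≡⟨ cong (coeff (scale b as) k +_) (coeff-⊕ (scale a q) _ k) ⟨
        coeff (scale b as) k + coeff (scale a q ⊕ (0ℤ ∷ as ⊗ q)) k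
          ≡⟨ coeff-⊕ (scale b as) _ k ⟨
        coeff (scale b as ⊕ (scale a q ⊕ (0ℤ ∷ as ⊗ q))) k ∎ }

  ⊗-comm : ∀ p q → p ⊗ q ≃ q ⊗ p
  ⊗-comm []       q = ≃-sym (⊗-zeroʳ q)
  ⊗-comm (a ∷ as) q =
    ≃-trans (⊕-cong (≃-refl {scale a q}) (∷-cong refl (⊗-comm as q))) (≃-sym (⊗-∷ q a as))

  ⊗-assoc : ∀ p q r → (p ⊗ q) ⊗ r ≃ p ⊗ (q ⊗ r)
  ⊗-assoc []       q r = ≃-refl
  ⊗-assoc (a ∷ as) q r =
    ≃-trans (⊗-distribʳ r (scale a q) (0ℤ ∷ as ⊗ q))
      (⊕-cong (scale-⊗ a q r) (≃-trans (0∷-⊗ (as ⊗ q) r) (∷-cong refl (⊗-assoc as q r))))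

  ⊗-identityˡ : ∀ p → oneP ⊗ p ≃ p
  ⊗-identityˡ p = ≃-trans (⊕-cong (scale-1 p) (0∷-≃[] ≃-refl)) (⊕-identityʳ p)

  ⊗-identityʳ : ∀ p → p ⊗ oneP ≃ p
  ⊗-identityʳ p = ≃-trans (⊗-comm p oneP) (⊗-identityˡ p)

  ⊗-distribˡ : ∀ p q r → p ⊗ (q ⊕ r) ≃ p ⊗ q ⊕ p ⊗ r
  ⊗-distribˡ p q r =
    ≃-trans (⊗-comm p (q ⊕ r)) (≃-trans (⊗-distribʳ p q r) (⊕-cong (⊗-comm q p) (⊗-comm r p)))

  ⊕-⊗-isCommutativeRing : IsCommutativeRing _≃_ _⊕_ _⊗_ negP [] oneP
  ⊕-⊗-isCommutativeRing = record
    { isRing = record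
      { +-isAbelianGroup = record
        { isGroup = record
          { isMonoid = record
            { isSemigroup = record
              { isMagma = record
                { isEquivalence = record { refl = ≃-refl ; sym = ≃-sym ; trans = ≃-trans }
                ; ∙-cong = ⊕-cong }
              ; assoc = ⊕-assoc }
            ; identity = ⊕-identityˡ , ⊕-identityʳ }
          ; inverse = ⊕-inverseˡ , ⊕-inverseʳ
          ; ⁻¹-cong = negP-cong }
        ; comm = ⊕-comm }
      ; *-cong = ⊗-cong
      ; *-assoc = ⊗-assoc
      ; *-identity = ⊗-identityˡ , ⊗-identityʳ
      ; distrib = ⊗-distribˡ , ⊗-distribʳ }
    ; *-comm = ⊗-comm }

  ℤ[X] : CommutativeRing 0ℓ 0ℓ
  ℤ[X] = record { isCommutativeRing = ⊕-⊗-isCommutativeRing }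

-- Congruences and the tournament expansion in a commutative ring

distinct : ∀ {n} → Fin n → Fin n → Bool
distinct i j = not (does (i ≟ᶠ j))

distinct⇒≢ : ∀ {n} (i j : Fin n) → distinct i j ≡ true → i ≢ j
distinct⇒≢ i j d with i ≟ᶠ j
distinct⇒≢ i j () | yes _
... | no i≢j = i≢j

module Tournament {c ℓ} (R : CommutativeRing c ℓ) where
  open CommutativeRing R hiding (zero)
    renaming (Carrier to A; refl to ≈-refl; sym to ≈-sym; trans to ≈-trans; reflexive to ≈-reflexive)
  open import Algebra.Properties.Ring ring using (-‿distribˡ-*)
  open import Algebra.Properties.CommutativeSemigroup.Divisibility *-commutativeSemigroup public
    using (_∣_; _,_)
  open import Algebra.Properties.CommutativeSemigroup.Divisibility *-commutativeSemigroup
    using (∙-cong-∣; x∣ʳy⇒x∣ʳzy; ∣ʳ-trans; x∣xy)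
  open import Algebra.Properties.CommutativeSemigroup *-commutativeSemigroup using (x∙yz≈y∙xz; interchange)
  open import Algebra.Properties.Monoid.Divisibility *-monoid using (∣-refl)
  open import Algebra.Properties.Semiring.Sum semiring public
    using (sum; *-distribˡ-sum) renaming (sum-cong-≋ to sum-cong)
  open import Algebra.Properties.Semiring.Sum semiring using (∑-distrib-+)
  open import Algebra.Properties.CommutativeMonoid.Sum *-commutativeMonoid public
    using () renaming (sum to ∏; sum-cong-≋ to ∏-cong; ∑-distrib-+ to ∏-distrib-*)
  open import Algebra.Properties.CommutativeMonoid.Sum *-commutativeMonoid
    using () renaming (sum-replicate-zero to ∏-replicate-1)
  open import Algebra.Solver.Ring.NaturalCoefficients.Default commutativeSemiring
    using (solve; _:=_; _:+_; _:*_)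
  module ≈-Reasoning = Relation.Binary.Reasoning.Setoid setoid

  infix 4 _≡_[mod_]
  record _≡_[mod_] (x y m : A) : Set (c ⊔ ℓ) where
    constructor _,_
    field
      quotient : A
      equation : x ≈ y + quotient * m

  ≈⇒≡mod : ∀ {m x y} → x ≈ y → x ≡ y [mod m ]
  ≈⇒≡mod {m} {x} {y} x≈y = 0# , (begin
    x             ≈⟨ x≈y ⟩
    y             ≈⟨ +-identityʳ y ⟨
    y + 0#        ≈⟨ +-congˡ (zeroˡ m) ⟨
    y + 0# * m    ∎)
    where open ≈-Reasoning

  mod-sym : ∀ {m x y} → x ≡ y [mod m ] → y ≡ x [mod m ]
  mod-sym {m} {x} {y} (q , x≈y+qm) = - q , (begin
    y                        ≈⟨ +-identityʳ y ⟨
    y + 0#                   ≈⟨ +-congˡ (-‿inverseʳ (q * m)) ⟨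
    y + (q * m - q * m)      ≈⟨ +-assoc y (q * m) _ ⟨
    (y + q * m) - q * m      ≈⟨ +-cong x≈y+qm (≈-sym (-‿distribˡ-* q m)) ⟨
    x + - q * m              ∎)
    where open ≈-Reasoning

  mod-trans : ∀ {m x y z} → x ≡ y [mod m ] → y ≡ z [mod m ] → x ≡ z [mod m ]
  mod-trans {m} {x} {y} {z} (q , x≈y+qm) (r , y≈z+rm) = r + q , (begin
    x                        ≈⟨ x≈y+qm ⟩
    y + q * m                ≈⟨ +-congʳ y≈z+rm ⟩
    (z + r * m) + q * m      ≈⟨ solve 4 (λ z r q m → (z :+ r :* m) :+ q :* m := z :+ (r :+ q) :* m) ≈-refl z r q m ⟩
    z + (r + q) * m          ∎)
    where open ≈-Reasoning

  ≡mod-setoid : A → Setoid c (c ⊔ ℓ)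
  ≡mod-setoid m = record
    { Carrier = A
    ; _≈_ = _≡_[mod m ]
    ; isEquivalence = record { refl = ≈⇒≡mod ≈-refl ; sym = mod-sym ; trans = mod-trans } }

  +-cong-mod : ∀ {m x y u v} → x ≡ y [mod m ] → u ≡ v [mod m ] → x + u ≡ y + v [mod m ]
  +-cong-mod {m} {x} {y} {u} {v} (q , x≈y+qm) (r , u≈v+rm) = q + r , (begin
    x + u                          ≈⟨ +-cong x≈y+qm u≈v+rm ⟩
    (y + q * m) + (v + r * m)      ≈⟨ solve 5 (λ y q v r m → (y :+ q :* m) :+ (v :+ r :* m) := (y :+ v) :+ (q :+ r) :* m) ≈-refl y q v r m ⟩
    (y + v) + (q + r) * m          ∎)
    where open ≈-Reasoning

  *-cong-mod : ∀ {m x y u v} → x ≡ y [mod m ] → u ≡ v [mod m ] → x * u ≡ y * v [mod m ]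
  *-cong-mod {m} {x} {y} {u} {v} (q , x≈y+qm) (r , u≈v+rm) = q * (v + r * m) + y * r , (begin
    x * u                          ≈⟨ *-cong x≈y+qm u≈v+rm ⟩
    (y + q * m) * (v + r * m)      ≈⟨ solve 5 (λ y q v r m → (y :+ q :* m) :* (v :+ r :* m)
                                                := y :* v :+ (q :* (v :+ r :* m) :+ y :* r) :* m) ≈-refl y q v r m ⟩
    y * v + (q * (v + r * m) + y * r) * m ∎)
    where open ≈-Reasoning

  *-cong-mod-∣ : ∀ {m k x y z} → k ∣ z → x ≡ y [mod m ] → x * z ≡ y * z [mod m * k ]
  *-cong-mod-∣ {m} {k} {x} {y} {z} (t , tk≈z) (q , x≈y+qm) = q * t , (begin
    x * z                          ≈⟨ *-cong x≈y+qm (≈-sym tk≈z) ⟩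
    (y + q * m) * (t * k)          ≈⟨ solve 5 (λ y q m t k → (y :+ q :* m) :* (t :* k)
                                                := y :* (t :* k) :+ (q :* t) :* (m :* k)) ≈-refl y q m t k ⟩
    y * (t * k) + (q * t) * (m * k) ≈⟨ +-congʳ (*-congˡ tk≈z) ⟩
    y * z + (q * t) * (m * k)      ∎)
    where open ≈-Reasoning

  ∣⇒≡0 : ∀ {m x} → m ∣ x → x ≡ 0# [mod m ]
  ∣⇒≡0 {m} {x} (q , qm≈x) = q , ≈-trans (≈-sym qm≈x) (≈-sym (+-identityˡ _))

  mod-weaken : ∀ {m m′ x y} → m ∣ m′ → x ≡ y [mod m′ ] → x ≡ y [mod m ]
  mod-weaken {m} {m′} {x} {y} (t , tm≈m′) (q , x≈y+qm′) = q * t , (begin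
    x                    ≈⟨ x≈y+qm′ ⟩
    y + q * m′           ≈⟨ +-congˡ (*-congˡ tm≈m′) ⟨
    y + q * (t * m)      ≈⟨ +-congˡ (*-assoc q t m) ⟨
    y + q * t * m        ∎)
    where open ≈-Reasoning

  mod-resp-≈ : ∀ {m m′ x y} → m ≈ m′ → x ≡ y [mod m ] → x ≡ y [mod m′ ]
  mod-resp-≈ m≈m′ = mod-weaken (1# , ≈-trans (*-identityˡ _) (≈-sym m≈m′))

  ∏-cong-mod : ∀ {n m} {f g : Fin n → A} → (∀ i → f i ≡ g i [mod m ]) → ∏ f ≡ ∏ g [mod m ]
  ∏-cong-mod {zero}  fg = ≈⇒≡mod ≈-refl
  ∏-cong-mod {suc n} fg = *-cong-mod (fg zero) (∏-cong-mod (fg ∘ suc))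

  sum-cong-mod : ∀ {n m} {f g : Fin n → A} → (∀ i → f i ≡ g i [mod m ]) → sum f ≡ sum g [mod m ]
  sum-cong-mod {zero}  fg = ≈⇒≡mod ≈-refl
  sum-cong-mod {suc n} fg = +-cong-mod (fg zero) (sum-cong-mod (fg ∘ suc))

  ∏-∣ : ∀ {n} {f g : Fin n → A} → (∀ i → f i ∣ g i) → ∏ f ∣ ∏ g
  ∏-∣ {zero}  fg = ∣-refl
  ∏-∣ {suc n} fg = ∙-cong-∣ (fg zero) (∏-∣ (fg ∘ suc))

  ∏-except : ∀ {n} → Fin n → (Fin n → A) → A
  ∏-except i f = ∏ λ j → if distinct i j then f j else 1#

  ∏-extract : ∀ {n} (f : Fin n → A) i → ∏ f ≈ f i * ∏-except i f
  ∏-extract f zero    = *-congˡ (≈-sym (*-identityˡ _))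
  ∏-extract f (suc i) = begin
    f zero * ∏ (f ∘ suc)                                   ≈⟨ *-congˡ (∏-extract (f ∘ suc) i) ⟩
    f zero * (f (suc i) * ∏-except i (f ∘ suc))            ≈⟨ x∙yz≈y∙xz (f zero) (f (suc i)) _ ⟩
    f (suc i) * (f zero * ∏-except i (f ∘ suc))            ∎
    where open ≈-Reasoning

  ∏-except-∣ : ∀ {n} i {f g : Fin n → A} → (∀ j → i ≢ j → f j ∣ g j) → ∏-except i f ∣ ∏-except i g
  ∏-except-∣ i fg = ∏-∣ λ j → masked (distinct i j) (λ d → fg j (distinct⇒≢ i j d))
    where
    masked : ∀ b {x y} → (b ≡ true → x ∣ y) → (if b then x else 1#) ∣ (if b then y else 1#)
    masked false _   = ∣-refl
    masked true  x∣y = x∣y refl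

  ∏-except-cong-mod : ∀ {n m} i {f g : Fin n → A} → (∀ j → f j ≡ g j [mod m ]) →
                      ∏-except i f ≡ ∏-except i g [mod m ]
  ∏-except-cong-mod i fg = ∏-cong-mod λ j → masked (distinct i j) (fg j)
    where
    masked : ∀ b {m x y} → x ≡ y [mod m ] → (if b then x else 1#) ≡ (if b then y else 1#) [mod m ]
    masked false _   = ≈⇒≡mod ≈-refl
    masked true  x≡y = x≡y

  ∏-pairs : ∀ {n} → (Fin n → Bool) → (Fin n → Fin n → A) → A
  ∏-pairs allowed E =
    ∏ λ j₁ → ∏ λ j₂ → if allowed j₁ ∧ allowed j₂ ∧ (toℕ j₁ <ᵇ toℕ j₂) then E j₁ j₂ else 1#

  ∏-pairs-suc : ∀ {n} (allowed : Fin (suc n) → Bool) (E : Fin (suc n) → Fin (suc n) → A) →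
    ∏-pairs allowed E ≈
    ∏ (λ k → if allowed zero ∧ allowed (suc k) then E zero (suc k) else 1#) *
    ∏-pairs (allowed ∘ suc) (λ j₁ j₂ → E (suc j₁) (suc j₂))
  ∏-pairs-suc allowed E = *-cong
    (≈-trans (*-cong (unmasked (allowed zero) (allowed zero))
                     (∏-cong λ k → ≈-reflexive (cong (λ b → if b then E zero (suc k) else 1#)
                                                      (cong (allowed zero ∧_) (∧-identityʳ (allowed (suc k)))))))
             (*-identityˡ _))
    (∏-cong λ j → ≈-trans (*-congʳ (unmasked (allowed (suc j)) (allowed zero))) (*-identityˡ _))
    where
    unmasked : ∀ a b {x} → (if a ∧ b ∧ false then x else 1#) ≈ 1#
    unmasked a b = ≈-reflexive (cong (λ t → if t then _ else 1#)
                                     (trans (cong (a ∧_) (∧-zeroʳ b)) (∧-zeroʳ a)))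

  sourceTerm : ∀ {n} → (E F : Fin n → Fin n → A) → Fin n → A
  sourceTerm E F i = ∏-except i (F i) * ∏-pairs (distinct i) E

  module ≡mod-Reasoning (m : A) = Relation.Binary.Reasoning.Setoid (≡mod-setoid m)

  mod-split : ∀ {d₀ dᵢ k e a b q q′ s} →
    e ≡ a + b [mod d₀ * dᵢ ] → dᵢ ∣ a → q ≡ q′ [mod d₀ ] → k ∣ s →
    e * q * s ≡ a * q′ * s + b * q * s [mod d₀ * (dᵢ * k) ]
  mod-split {d₀} {dᵢ} {k} {e} {a} {b} {q} {q′} {s} e≡a+b dᵢ∣a q≡q′ k∣s = begin
    e * q * s                       ≈⟨ ≈⇒≡mod (*-assoc e q s) ⟩
    e * (q * s)                     ≈⟨ mod-resp-≈ (*-assoc d₀ dᵢ k) (*-cong-mod-∣ (x∣ʳy⇒x∣ʳzy q k∣s) e≡a+b) ⟩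
    (a + b) * (q * s)               ≈⟨ ≈⇒≡mod (solve 4 (λ a b q s → (a :+ b) :* (q :* s) := q :* (a :* s) :+ b :* q :* s) ≈-refl a b q s) ⟩
    q * (a * s) + b * q * s         ≈⟨ +-cong-mod (*-cong-mod-∣ (∙-cong-∣ dᵢ∣a k∣s) q≡q′) (≈⇒≡mod ≈-refl) ⟩
    q′ * (a * s) + b * q * s        ≈⟨ ≈⇒≡mod (+-congʳ (solve 3 (λ q a s → q :* (a :* s) := a :* q :* s) ≈-refl q′ a s)) ⟩
    a * q′ * s + b * q * s          ∎
    where open ≡mod-Reasoning (d₀ * (dᵢ * k))

  tail² : ∀ {m} → (Fin (suc m) → Fin (suc m) → A) → Fin m → Fin m → A
  tail² E j₁ j₂ = E (suc j₁) (suc j₂)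

  sourceTerm-zero : ∀ {m} (E F : Fin (suc m) → Fin (suc m) → A) →
    sourceTerm E F zero ≈ ∏ (λ k → F zero (suc k)) * ∏-pairs (λ _ → true) (tail² E)
  sourceTerm-zero {m} E F = *-cong (*-identityˡ _)
    (≈-trans (∏-pairs-suc (distinct zero) E) (≈-trans (*-congʳ (∏-replicate-1 m)) (*-identityˡ _)))

  sourceTerm-suc : ∀ {m} (E F : Fin (suc m) → Fin (suc m) → A) i →
    sourceTerm E F (suc i) ≈
    (F (suc i) zero * ∏-except i (λ k → E zero (suc k))) * sourceTerm (tail² E) (tail² F) i
  sourceTerm-suc E F i = ≈-trans (*-congˡ (∏-pairs-suc (distinct (suc i)) E)) (interchange _ _ _ _)

  module _ {m} (d : Fin (suc m) → A) (E F : Fin (suc m) → Fin (suc m) → A)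
           (d∣F : ∀ i j → i ≢ j → d j ∣ F i j)
           (E≡F+F : ∀ k → E zero (suc k) ≡ F zero (suc k) + F (suc k) zero [mod d zero * d (suc k) ])
           where
    private
      e a b : Fin m → A
      e k = E zero (suc k)
      a k = F zero (suc k)
      b k = F (suc k) zero
      s : Fin m → A
      s = sourceTerm (tail² E) (tail² F)

    E≡F-mod-d₀ : ∀ k → e k ≡ a k [mod d zero ]
    E≡F-mod-d₀ k = mod-trans (mod-weaken (x∣xy (d zero) (d (suc k))) (E≡F+F k))
                             (mod-trans (+-cong-mod (≈⇒≡mod ≈-refl) (∣⇒≡0 (d∣F (suc k) zero λ ())))
                                        (≈⇒≡mod (+-identityʳ (a k))))

    sourceTerm-lift : ∀ i → ∏ e * s i ≡ ∏ a * s i + sourceTerm E F (suc i) [mod ∏ d ]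
    sourceTerm-lift i = begin
      ∏ e * s i                                      ≈⟨ ≈⇒≡mod (*-congʳ (∏-extract e i)) ⟩
      e i * ∏-except i e * s i
        ≈⟨ mod-resp-≈ (*-congˡ (≈-sym (∏-extract (d ∘ suc) i)))
             (mod-split (E≡F+F i) (d∣F zero (suc i) λ ()) (∏-except-cong-mod i E≡F-mod-d₀)
                        (∣ʳ-trans (∏-except-∣ i λ j i≢j → d∣F (suc i) (suc j) (i≢j ∘ suc-injective))
                                  (x∣xy _ _))) ⟩
      a i * ∏-except i a * s i + b i * ∏-except i e * s i
        ≈⟨ ≈⇒≡mod (+-cong (*-congʳ (≈-sym (∏-extract a i))) (≈-sym (sourceTerm-suc E F i))) ⟩
      ∏ a * s i + sourceTerm E F (suc i)             ∎
      where open ≡mod-Reasoning (∏ d)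

    expansion-step : ∏-pairs (λ _ → true) (tail² E) ≡ sum s [mod ∏ (d ∘ suc) ] →
                     ∏-pairs (λ _ → true) E ≡ sum (sourceTerm E F) [mod ∏ d ]
    expansion-step (w , T′≈Σ′+wD′) = begin
      ∏-pairs (λ _ → true) E                 ≈⟨ ≈⇒≡mod (∏-pairs-suc (λ _ → true) E) ⟩
      ∏ e * T′                               ≈⟨ ≈⇒≡mod (≈-trans (*-congˡ T′≈Σ′+wD′) (distribˡ _ _ _)) ⟩
      ∏ e * sum s + ∏ e * (w * D′)           ≈⟨ +-cong-mod (≈⇒≡mod (*-distribˡ-sum (∏ e) s)) ∏e≡∏a ⟩
      sum (λ i → ∏ e * s i) + ∏ a * (w * D′) ≈⟨ +-cong-mod (sum-cong-mod sourceTerm-lift) (≈⇒≡mod ≈-refl) ⟩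
      sum (λ i → ∏ a * s i + S (suc i)) + ∏ a * (w * D′)
        ≈⟨ ≈⇒≡mod (+-congʳ (≈-trans (∑-distrib-+ (λ i → ∏ a * s i) (S ∘ suc))
                                     (+-congʳ (≈-sym (*-distribˡ-sum (∏ a) s))))) ⟩
      (∏ a * sum s + sum (S ∘ suc)) + ∏ a * (w * D′)
        ≈⟨ ≈⇒≡mod (solve 4 (λ x y z u → (x :* y :+ z) :+ x :* u := x :* (y :+ u) :+ z) ≈-refl (∏ a) (sum s) _ _) ⟩
      ∏ a * (sum s + w * D′) + sum (S ∘ suc) ≈⟨ ≈⇒≡mod (+-congʳ (≈-trans (*-congˡ (≈-sym T′≈Σ′+wD′))
                                                                        (≈-sym (sourceTerm-zero E F)))) ⟩
      S zero + sum (S ∘ suc)                 ∎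
      where
      open ≡mod-Reasoning (∏ d)
      D′ = ∏ (d ∘ suc)
      T′ = ∏-pairs (λ _ → true) (tail² E)
      S = sourceTerm E F
      ∏e≡∏a : ∏ e * (w * D′) ≡ ∏ a * (w * D′) [mod ∏ d ]
      ∏e≡∏a = *-cong-mod-∣ (x∣ʳy⇒x∣ʳzy w ∣-refl) (∏-cong-mod E≡F-mod-d₀)

  ∏-pairs≡∑sourceTerm : ∀ {n} (d : Fin n → A) (E F : Fin n → Fin n → A) →
    (∀ i j → i ≢ j → d j ∣ F i j) →
    (∀ i j → toℕ i < toℕ j → E i j ≡ F i j + F j i [mod d i * d j ]) →
    ∏-pairs (λ _ → true) E ≡ sum (sourceTerm E F) [mod ∏ d ]
  ∏-pairs≡∑sourceTerm {zero}  d E F d∣F E≡F+F = 1# , ≈-sym (≈-trans (+-identityˡ _) (*-identityˡ _))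
  ∏-pairs≡∑sourceTerm {suc m} d E F d∣F E≡F+F = expansion-step d E F d∣F (λ k → E≡F+F zero (suc k) (s≤s z≤n))
    (∏-pairs≡∑sourceTerm (d ∘ suc) (tail² E) (tail² F)
      (λ i j i≢j → d∣F (suc i) (suc j) (i≢j ∘ suc-injective))
      (λ i j i<j → E≡F+F (suc i) (suc j) (s≤s i<j)))

-- Modular inverses and the exponents N_i, N_ij

open import Data.Nat using (_+_; _*_; _∸_; _≡ᵇ_; NonZero; >-nonZero; nonTrivial⇒n>1)
open import Data.Nat.DivMod using (_%_; _/_; m≡m%n+[m/n]*n; [m+kn]%n≡m%n; m%n<n; m<n⇒m%n≡m; m*n/n≡m; %-distribˡ-*; m%n%n≡m%n)
open import Data.Nat.Coprimality using (Coprime; coprime-Bézout; coprime-divisor)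
open import Data.Nat.GCD using (module Bézout)
open import Data.Nat.Primality using (prime⇒irreducible; prime⇒nonTrivial)
import Data.Nat.Divisibility as ∣ℕ
open ∣ℕ using (divides) renaming (_∣_ to _∣ℕ_)
import Data.Nat.Properties as ℕ
open import Data.Nat.Tactic.RingSolver using (solve; solve-∀)
open import Data.Empty using (⊥-elim)
open import Data.Unit using (tt)
open import Data.Bool using (T)
open import Data.List.Membership.Propositional using (_∈_)
open import Data.List.Membership.Propositional.Properties using (∈-allFin)
open import Data.List.Relation.Unary.Any using (here; there)

-- `invMod` searches with a loop local to its where-block, which cannot be named here.  Checking
-- `invMod-unfolds` solves the meta `search` with that loop, so `invMod b (suc m)` is definitionally
-- `search b m 0 (suc m)`.
mutual
  search : ℕ → ℕ → ℕ → ℕ → ℕ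
  search b m = _

  invMod-unfolds : (b m : ℕ) → invMod b (suc (suc m)) ≡ invMod b (suc (suc m))
  invMod-unfolds b m with (1 * b) % suc (suc m) ≡ᵇ 1 % suc (suc m)
  ... | true  = refl
  ... | false with suc m | 2
  ...   | m′ | k = refl {x = search b m′ k m}

IsInverseMod : ℕ → ℕ → ℕ → Set
IsInverseMod b m k = (k * b) % suc m ≡ 1 % suc m

search-finds : ∀ b m f k k₀ → k ≤ k₀ → k₀ < k + f → IsInverseMod b m k₀ →
               IsInverseMod b m (search b m k f) × search b m k f < k + f
search-finds b m zero    k k₀ k≤k₀ k₀<k+0 _ = ⊥-elim (ℕ.<⇒≱ (subst (k₀ <_) (ℕ.+-identityʳ k) k₀<k+0) k≤k₀)
search-finds b m (suc f) k k₀ k≤k₀ k₀<k+f k₀-inv with (k * b) % suc m ≡ᵇ 1 % suc m in eq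
... | true  = ℕ.≡ᵇ⇒≡ _ _ (subst T (sym eq) tt) , ℕ.m<m+n k (s≤s z≤n)
... | false = proj₁ found , subst (search b m (suc k) f <_) (sym (ℕ.+-suc k f)) (proj₂ found)
  where
  k≢k₀ : k ≢ k₀
  k≢k₀ refl = subst T eq (ℕ.≡⇒≡ᵇ _ _ k₀-inv)
  found = search-finds b m f (suc k) k₀ (ℕ.≤∧≢⇒< k≤k₀ k≢k₀) (subst (k₀ <_) (ℕ.+-suc k f) k₀<k+f) k₀-inv

invMod-spec : ∀ b m k₀ → k₀ < suc m → IsInverseMod b m k₀ →
              IsInverseMod b m (invMod b (suc m)) × invMod b (suc m) < suc m
invMod-spec b m k₀ = search-finds b m (suc m) 0 k₀ z≤n

%-*-absorbˡ : ∀ x b n .{{_ : NonZero n}} → ((x % n) * b) % n ≡ (x * b) % n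
%-*-absorbˡ x b n = begin
  ((x % n) * b) % n               ≡⟨ %-distribˡ-* (x % n) b n ⟩
  ((x % n % n) * (b % n)) % n     ≡⟨ cong (λ y → (y * (b % n)) % n) (m%n%n≡m%n x n) ⟩
  ((x % n) * (b % n)) % n         ≡⟨ %-distribˡ-* x b n ⟨
  (x * b) % n                     ∎
  where open ≡-Reasoning

inverse-exists : ∀ {b} m → Coprime b (suc m) → ∃ λ k → k < suc m × IsInverseMod b m k
inverse-exists {b} m b⊥m with coprime-Bézout b⊥m
... | Bézout.+- x y 1+ym≡xb = x % suc m , m%n<n x (suc m) , (begin
  ((x % suc m) * b) % suc m    ≡⟨ %-*-absorbˡ x b (suc m) ⟩
  (x * b) % suc m              ≡⟨ cong (_% suc m) 1+ym≡xb ⟨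
  (1 + y * suc m) % suc m      ≡⟨ [m+kn]%n≡m%n 1 y (suc m) ⟩
  1 % suc m                    ∎)
  where open ≡-Reasoning
-- Here x b ≡ -1, and m ≡ -1 modulo suc m.
... | Bézout.-+ x y 1+xb≡ym = (m * x) % suc m , m%n<n (m * x) (suc m) , (begin
  ((m * x) % suc m * b) % suc m                ≡⟨ %-*-absorbˡ (m * x) b (suc m) ⟩
  (m * x * b) % suc m                          ≡⟨ [m+kn]%n≡m%n (m * x * b) 1 (suc m) ⟨
  (m * x * b + 1 * suc m) % suc m              ≡⟨ cong (_% suc m) (shift m x b) ⟩
  (1 + m * (1 + x * b)) % suc m                ≡⟨ cong (λ z → (1 + m * z) % suc m) 1+xb≡ym ⟩
  (1 + m * (y * suc m)) % suc m                ≡⟨ cong (λ z → (1 + z) % suc m) (ℕ.*-assoc m y (suc m)) ⟨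
  (1 + (m * y) * suc m) % suc m                ≡⟨ [m+kn]%n≡m%n 1 (m * y) (suc m) ⟩
  1 % suc m                                    ∎)
  where
  open ≡-Reasoning
  shift : ∀ m x b → m * x * b + 1 * suc m ≡ 1 + m * (1 + x * b)
  shift = solve-∀

invMod-inverse : ∀ {b m} → 1 < m → Coprime b m → invMod b m < m × ∃ λ t → invMod b m * b ≡ 1 + t * m
invMod-inverse {b} {suc m} 1<m b⊥m = c<m , (c * b) / suc m , (begin
  c * b                                    ≡⟨ m≡m%n+[m/n]*n (c * b) (suc m) ⟩
  (c * b) % suc m + (c * b) / suc m * suc m ≡⟨ cong (_+ (c * b) / suc m * suc m) (trans c-inv (m<n⇒m%n≡m 1<m)) ⟩
  1 + (c * b) / suc m * suc m              ∎)
  where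
  open ≡-Reasoning
  c = invMod b (suc m)
  spec = let (k₀ , k₀<m , k₀-inv) = inverse-exists m b⊥m in invMod-spec b m k₀ k₀<m k₀-inv
  c-inv = proj₁ spec
  c<m = proj₂ spec

prime⇒1< : ∀ {P} → Prime P → 1 < P
prime⇒1< {P} pP = nonTrivial⇒n>1 P {{prime⇒nonTrivial pP}}

primes-coprime : ∀ {P Q} → Prime P → Prime Q → P ≢ Q → Coprime P Q
primes-coprime pP pQ P≢Q (d∣P , d∣Q) with prime⇒irreducible pP d∣P
... | inj₁ d≡1 = d≡1
... | inj₂ refl with prime⇒irreducible pQ d∣Q
...   | inj₁ P≡1 = ⊥-elim (ℕ.<⇒≢ (prime⇒1< pP) (sym P≡1))
...   | inj₂ P≡Q = ⊥-elim (P≢Q P≡Q)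

multiple-between : ∀ {x Q} → Q ∣ℕ x → 0 < x → x < Q + Q → x ≡ Q
multiple-between (divides zero refl) () _
multiple-between (divides 1 x≡1*Q) _ _ = trans x≡1*Q (ℕ.+-identityʳ _)
multiple-between {Q = Q} (divides (suc (suc q)) refl) _ x<2Q =
  ⊥-elim (ℕ.<⇒≱ x<2Q (ℕ.+-monoʳ-≤ Q (ℕ.m≤m+n Q (q * Q))))

record InversePair (P Q : ℕ) : Set where
  field
    t s      : ℕ
    inverseˡ : invMod P Q * P ≡ 1 + t * Q
    inverseʳ : invMod Q P * Q ≡ 1 + s * P
    product  : P * Q ≡ 1 + t * Q + s * P

inversePair : ∀ {P Q} → Prime P → Prime Q → P ≢ Q → InversePair P Q
inversePair {P} {Q} pP pQ P≢Q
  with invMod-inverse (prime⇒1< pQ) (primes-coprime pP pQ P≢Q)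
     | invMod-inverse (prime⇒1< pP) (primes-coprime pQ pP (P≢Q ∘ sym))
... | c<Q , t , cP≡1+tQ | c′<P , s , c′Q≡1+sP =
  record { t = t ; s = s ; inverseˡ = cP≡1+tQ ; inverseʳ = c′Q≡1+sP ; product = PQ≡1+tQ+sP }
  where
  c = invMod P Q
  c′ = invMod Q P
  instance
    Q≢0 : NonZero Q
    Q≢0 = >-nonZero (ℕ.<-trans (s≤s z≤n) (prime⇒1< pQ))

  s<Q : s < Q
  s<Q = ℕ.*-cancelʳ-< P s Q (begin-strict
    s * P         <⟨ ℕ.n<1+n (s * P) ⟩
    1 + s * P     ≡⟨ c′Q≡1+sP ⟨
    c′ * Q        <⟨ ℕ.*-monoˡ-< Q c′<P ⟩
    P * Q         ≡⟨ ℕ.*-comm P Q ⟩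
    Q * P         ∎)
    where open ℕ.≤-Reasoning

  [c+s]P≡[c′+t]Q : (c + s) * P ≡ (c′ + t) * Q
  [c+s]P≡[c′+t]Q = begin
    (c + s) * P           ≡⟨ ℕ.*-distribʳ-+ P c s ⟩
    c * P + s * P         ≡⟨ cong (_+ s * P) cP≡1+tQ ⟩
    1 + t * Q + s * P     ≡⟨ solve (t ∷ Q ∷ s ∷ P ∷ []) ⟩
    1 + s * P + t * Q     ≡⟨ cong (_+ t * Q) c′Q≡1+sP ⟨
    c′ * Q + t * Q        ≡⟨ ℕ.*-distribʳ-+ Q c′ t ⟨
    (c′ + t) * Q          ∎
    where open ≡-Reasoning

  0<c : 0 < c
  0<c = ℕ.n≢0⇒n>0 λ c≡0 → ℕ.0≢1+n (trans (cong (_* P) (sym c≡0)) cP≡1+tQ)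

  c+s≡Q : c + s ≡ Q
  c+s≡Q = multiple-between
    (coprime-divisor (primes-coprime pQ pP (P≢Q ∘ sym))
                     (divides (c′ + t) (trans (ℕ.*-comm P (c + s)) [c+s]P≡[c′+t]Q)))
    (ℕ.<-≤-trans 0<c (ℕ.m≤m+n c s))
    (ℕ.+-mono-< c<Q s<Q)

  PQ≡1+tQ+sP : P * Q ≡ 1 + t * Q + s * P
  PQ≡1+tQ+sP = begin
    P * Q              ≡⟨ ℕ.*-comm P Q ⟩
    Q * P              ≡⟨ cong (_* P) c+s≡Q ⟨
    (c + s) * P        ≡⟨ ℕ.*-distribʳ-+ P c s ⟩
    c * P + s * P      ≡⟨ cong (_+ s * P) cP≡1+tQ ⟩
    1 + t * Q + s * P  ∎
    where open ≡-Reasoning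

scaleInversePair : ∀ {P Q c c′ t s} M → c * P ≡ 1 + t * Q → c′ * Q ≡ 1 + s * P → P * Q ≡ 1 + t * Q + s * P →
  c * (M * P) ≡ M + t * (M * Q) × c′ * (M * Q) ≡ M + s * (M * P) × M * (P * Q) ≡ M + t * (M * Q) + s * (M * P)
scaleInversePair {P} {Q} {c} {c′} {t} {s} M cP c′Q PQ =
  (begin
    c * (M * P)         ≡⟨ solve (c ∷ M ∷ P ∷ []) ⟩
    M * (c * P)         ≡⟨ cong (M *_) cP ⟩
    M * (1 + t * Q)     ≡⟨ solve (M ∷ t ∷ Q ∷ []) ⟩
    M + t * (M * Q)     ∎) ,
  (begin
    c′ * (M * Q)        ≡⟨ solve (c′ ∷ M ∷ Q ∷ []) ⟩
    M * (c′ * Q)        ≡⟨ cong (M *_) c′Q ⟩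
    M * (1 + s * P)     ≡⟨ solve (M ∷ s ∷ P ∷ []) ⟩
    M + s * (M * P)     ∎) ,
  (begin
    M * (P * Q)                     ≡⟨ cong (M *_) PQ ⟩
    M * (1 + t * Q + s * P)         ≡⟨ solve (M ∷ t ∷ Q ∷ s ∷ P ∷ []) ⟩
    M + t * (M * Q) + s * (M * P)   ∎)
  where open ≡-Reasoning

quot-≡ : ∀ {N m k} → 0 < k → N ≡ m * k → quot N k ≡ m
quot-≡ {m = m} {k = suc k} _ refl = m*n/n≡m m (suc k)

module _ {n} (p : Fin n → ℕ) where

  ∣-prodN : ∀ {i} {l : List (Fin n)} → i ∈ l → p i ∣ℕ prodN p l
  ∣-prodN {l = j ∷ l} (here refl) = ∣ℕ.m∣m*n (prodN p l)
  ∣-prodN {l = j ∷ l} (there i∈l) = ∣ℕ.∣n⇒∣m*n (p j) (∣-prodN i∈l)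

  p∣NN : ∀ i → p i ∣ℕ NN p
  p∣NN i = ∣-prodN (∈-allFin i)

  NN≡N₁*p : ∀ i → 0 < p i → NN p ≡ N₁ p i * p i
  NN≡N₁*p i 0<pᵢ with p∣NN i
  ... | divides q N≡q*pᵢ = trans N≡q*pᵢ (cong (_* p i) (sym (quot-≡ {m = q} 0<pᵢ N≡q*pᵢ)))

  NN-pair : ∀ i j → Coprime (p j) (p i) → ∃ λ M → NN p ≡ M * (p i * p j)
  NN-pair i j pⱼ⊥pᵢ with p∣NN i
  ... | divides q N≡q*pᵢ with coprime-divisor pⱼ⊥pᵢ (subst (p j ∣ℕ_) (trans N≡q*pᵢ (ℕ.*-comm q (p i))) (p∣NN j))
  ...   | divides M q≡M*pⱼ = M , (begin
    NN p                ≡⟨ N≡q*pᵢ ⟩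
    q * p i             ≡⟨ cong (_* p i) q≡M*pⱼ ⟩
    M * p j * p i       ≡⟨ ℕ.*-assoc M (p j) (p i) ⟩
    M * (p j * p i)     ≡⟨ cong (M *_) (ℕ.*-comm (p j) (p i)) ⟩
    M * (p i * p j)     ∎)
    where open ≡-Reasoning

  record PairExponents (i j : Fin n) : Set where
    field
      M t s : ℕ
      N₂≡M  : N₂ p i j ≡ M
      cNⱼ≡  : invMod (p i) (p j) * N₁ p j ≡ M + t * N₁ p i
      c′Nᵢ≡ : invMod (p j) (p i) * N₁ p i ≡ M + s * N₁ p j
      NN≡   : NN p ≡ M + t * N₁ p i + s * N₁ p j

  pairExponents : ∀ i j → Prime (p i) → Prime (p j) → p i ≢ p j → PairExponents i j
  pairExponents i j pᵢ pⱼ pᵢ≢pⱼ = record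
    { M = M ; t = t ; s = s
    ; N₂≡M  = quot-≡ (ℕ.*-mono-< 0<P 0<Q) N≡MPQ
    ; cNⱼ≡  = subst₂ (λ x y → invMod P Q * y ≡ M + t * x) (sym N₁ᵢ≡MQ) (sym N₁ⱼ≡MP) cMP≡
    ; c′Nᵢ≡ = subst₂ (λ x y → invMod Q P * x ≡ M + s * y) (sym N₁ᵢ≡MQ) (sym N₁ⱼ≡MP) c′MQ≡
    ; NN≡   = trans N≡MPQ (subst₂ (λ x y → M * (P * Q) ≡ M + t * x + s * y) (sym N₁ᵢ≡MQ) (sym N₁ⱼ≡MP) MPQ≡) }
    where
    P = p i
    Q = p j
    0<P = ℕ.<-trans (s≤s z≤n) (prime⇒1< pᵢ)
    0<Q = ℕ.<-trans (s≤s z≤n) (prime⇒1< pⱼ)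
    M,N≡MPQ = NN-pair i j (primes-coprime pⱼ pᵢ (pᵢ≢pⱼ ∘ sym))
    M = proj₁ M,N≡MPQ
    N≡MPQ : NN p ≡ M * (P * Q)
    N≡MPQ = proj₂ M,N≡MPQ
    N₁ᵢ≡MQ : N₁ p i ≡ M * Q
    N₁ᵢ≡MQ = quot-≡ 0<P (trans N≡MPQ (trans (cong (M *_) (ℕ.*-comm P Q)) (sym (ℕ.*-assoc M Q P))))
    N₁ⱼ≡MP : N₁ p j ≡ M * P
    N₁ⱼ≡MP = quot-≡ 0<Q (trans N≡MPQ (sym (ℕ.*-assoc M P Q)))
    open InversePair (inversePair pᵢ pⱼ pᵢ≢pⱼ)
    scaled = scaleInversePair {P} {Q} {invMod P Q} {invMod Q P} {t} {s} M inverseˡ inverseʳ product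
    cMP≡ = proj₁ scaled
    c′MQ≡ = proj₁ (proj₂ scaled)
    MPQ≡ = proj₂ (proj₂ scaled)

-- Binomials 1 - x^k

open PolynomialRing using (_≃_; coeff-≡; ≃-refl; ≃-sym; ≃-trans; ℤ[X])
module ℤX = CommutativeRing ℤ[X]
open Tournament ℤ[X]
  using (_∣_; _,_; _≡_[mod_]; ∏; ∏-cong; ∏-distrib-*; ∏-except; sum; sum-cong; *-distribˡ-sum; ∏-pairs; sourceTerm; ∏-pairs≡∑sourceTerm;
         ≈⇒≡mod; mod-sym; mod-trans; mod-resp-≈)

module ℤX-Solver where
  import Algebra.Solver.Ring.AlmostCommutativeRing as ACR
  open ACR using (_-Raw-AlmostCommutative⟶_; Induced-equivalence)
  open import Data.Integer using (ℤ; _≟_; +-*-rawRing)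
  open import Data.Maybe using (Maybe; just; nothing)

  constant : ℤ → Poly
  constant z = z ∷ []

  constant-homomorphism : +-*-rawRing -Raw-AlmostCommutative⟶ ACR.fromCommutativeRing ℤ[X]
  constant-homomorphism = record
    { ⟦_⟧    = constant
    ; +-homo = λ _ _ → ≃-refl
    ; *-homo = λ a b → PolynomialRing.coeffwise λ { zero → sym (ℤ.+-identityʳ _) ; (suc k) → refl }
    ; -‿homo = λ _ → ≃-refl
    ; 0-homo = PolynomialRing.coeffwise λ { zero → refl ; (suc k) → refl }
    ; 1-homo = ≃-refl
    }

  constant-equal? : ∀ a b → Maybe (Induced-equivalence constant-homomorphism a b)
  constant-equal? a b with a ≟ b
  ... | yes refl = just ≃-refl
  ... | no _     = nothing

  open import Algebra.Solver.Ring +-*-rawRing (ACR.fromCommutativeRing ℤ[X]) constant-homomorphism constant-equal?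
    public using (solve; _:=_; _:+_; _:*_; :-_; _:-_; con)

open import Data.Integer using (1ℤ)
open ℤX-Solver using (_:=_; _:+_; _:*_; :-_; _:-_; con) renaming (solve to solveℤ[X])
module ≃-Reasoning = Relation.Binary.Reasoning.Setoid ℤX.setoid

≡⇒≃ : ∀ {p q} → p ≡ q → p ≃ q
≡⇒≃ refl = ≃-refl

X^-+ : ∀ m n → X^ (m + n) ≃ X^ m ⊗ X^ n
X^-+ zero    n = ≃-sym (ℤX.*-identityˡ (X^ n))
X^-+ (suc m) n = ≃-trans (PolynomialRing.∷-cong refl (X^-+ m n)) (≃-sym (PolynomialRing.0∷-⊗ (X^ m) (X^ n)))

1-X^-∣-1-X^-* : ∀ m k → 1-X^ k ∣ 1-X^ (m * k)
1-X^-∣-1-X^-* zero    k = [] , ≃-sym (ℤX.-‿inverseʳ oneP)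
1-X^-∣-1-X^-* (suc m) k with 1-X^-∣-1-X^-* m k
... | q , q[1-Xᵏ]≃1-Xᵐᵏ = oneP ⊕ X^ k ⊗ q , (begin
  (oneP ⊕ X^ k ⊗ q) ⊗ 1-X^ k
    ≈⟨ solveℤ[X] 2 (λ X Q → (con 1ℤ :+ X :* Q) :* (con 1ℤ :- X) := (con 1ℤ :- X) :+ X :* (Q :* (con 1ℤ :- X))) ≃-refl (X^ k) q ⟩
  1-X^ k ⊕ X^ k ⊗ (q ⊗ 1-X^ k)                ≈⟨ ℤX.+-congˡ {1-X^ k} (ℤX.*-congˡ {X^ k} q[1-Xᵏ]≃1-Xᵐᵏ) ⟩
  1-X^ k ⊕ X^ k ⊗ 1-X^ (m * k)
    ≈⟨ solveℤ[X] 2 (λ X Y → (con 1ℤ :- X) :+ X :* (con 1ℤ :- Y) := con 1ℤ :- X :* Y) ≃-refl (X^ k) (X^ (m * k)) ⟩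
  oneP ⊕ negP (X^ k ⊗ X^ (m * k))             ≈⟨ ℤX.+-congˡ {oneP} (ℤX.-‿cong (X^-+ k (m * k))) ⟨
  1-X^ (k + m * k)                            ∎)
  where open ≃-Reasoning

1-X^-∣-X^-X^ : ∀ a r k → 1-X^ k ∣ X^ (a + r * k) ⊕ negP (X^ a)
1-X^-∣-X^-X^ a r k with 1-X^-∣-1-X^-* r k
... | q , q[1-Xᵏ]≃1-Xʳᵏ = negP (X^ a ⊗ q) , (begin
  negP (X^ a ⊗ q) ⊗ 1-X^ k
    ≈⟨ solveℤ[X] 3 (λ A Q X → (:- (A :* Q)) :* (con 1ℤ :- X) := :- (A :* (Q :* (con 1ℤ :- X)))) ≃-refl (X^ a) q (X^ k) ⟩
  negP (X^ a ⊗ (q ⊗ 1-X^ k))                  ≈⟨ ℤX.-‿cong (ℤX.*-congˡ {X^ a} q[1-Xᵏ]≃1-Xʳᵏ) ⟩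
  negP (X^ a ⊗ 1-X^ (r * k))
    ≈⟨ solveℤ[X] 2 (λ A Y → :- (A :* (con 1ℤ :- Y)) := A :* Y :- A) ≃-refl (X^ a) (X^ (r * k)) ⟩
  X^ a ⊗ X^ (r * k) ⊕ negP (X^ a)             ≈⟨ ℤX.+-congʳ {negP (X^ a)} (X^-+ a (r * k)) ⟨
  X^ (a + r * k) ⊕ negP (X^ a)                ∎)
  where open ≃-Reasoning

-- With Y = x^M, A = x^{u Nᵢ}, B = x^{v Nⱼ} the left side is (1 - Y) + Y (1 - A) (1 - B),
-- and 1 - A, 1 - B are multiples of 1 - x^{Nᵢ}, 1 - x^{Nⱼ}.
pair-congruence : ∀ {M a b N} u v Nᵢ Nⱼ → a ≡ M + u * Nᵢ → b ≡ M + v * Nⱼ → N ≡ M + u * Nᵢ + v * Nⱼ →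
  1-X^ a ⊕ (X^ N ⊕ negP (X^ b)) ≡ 1-X^ M [mod 1-X^ Nᵢ ⊗ 1-X^ Nⱼ ]
pair-congruence {M} u v Nᵢ Nⱼ refl refl refl
  with 1-X^-∣-1-X^-* u Nᵢ | 1-X^-∣-1-X^-* v Nⱼ
... | qᵢ , qᵢdᵢ≃1-A | qⱼ , qⱼdⱼ≃1-B = Y ⊗ qᵢ ⊗ qⱼ , (begin
  1-X^ (M + u * Nᵢ) ⊕ (X^ (M + u * Nᵢ + v * Nⱼ) ⊕ negP (X^ (M + v * Nⱼ)))
    ≈⟨ ℤX.+-cong (ℤX.+-congˡ {oneP} (ℤX.-‿cong (X^-+ M (u * Nᵢ))))
                 (ℤX.+-cong (≃-trans (X^-+ (M + u * Nᵢ) (v * Nⱼ)) (ℤX.*-congʳ {B} (X^-+ M (u * Nᵢ))))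
                            (ℤX.-‿cong (X^-+ M (v * Nⱼ)))) ⟩
  (oneP ⊕ negP (Y ⊗ A)) ⊕ (Y ⊗ A ⊗ B ⊕ negP (Y ⊗ B))
    ≈⟨ solveℤ[X] 3 (λ Y A B → (con 1ℤ :- Y :* A) :+ (Y :* A :* B :- Y :* B)
                            := (con 1ℤ :- Y) :+ Y :* ((con 1ℤ :- A) :* (con 1ℤ :- B))) ≃-refl Y A B ⟩
  1-X^ M ⊕ Y ⊗ (1-X^ (u * Nᵢ) ⊗ 1-X^ (v * Nⱼ))
    ≈⟨ ℤX.+-congˡ {1-X^ M} (ℤX.*-congˡ {Y} (ℤX.*-cong qᵢdᵢ≃1-A qⱼdⱼ≃1-B)) ⟨
  1-X^ M ⊕ Y ⊗ ((qᵢ ⊗ 1-X^ Nᵢ) ⊗ (qⱼ ⊗ 1-X^ Nⱼ))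
    ≈⟨ ℤX.+-congˡ {1-X^ M} (solveℤ[X] 5 (λ Y qᵢ dᵢ qⱼ dⱼ → Y :* ((qᵢ :* dᵢ) :* (qⱼ :* dⱼ)) := Y :* qᵢ :* qⱼ :* (dᵢ :* dⱼ))
                                ≃-refl Y qᵢ (1-X^ Nᵢ) qⱼ (1-X^ Nⱼ)) ⟩
  1-X^ M ⊕ Y ⊗ qᵢ ⊗ qⱼ ⊗ (1-X^ Nᵢ ⊗ 1-X^ Nⱼ) ∎)
  where
  open ≃-Reasoning
  Y = X^ M
  A = X^ (u * Nᵢ)
  B = X^ (v * Nⱼ)

-- The polynomials of the theorem

prodP-++ : ∀ l₁ l₂ → prodP (l₁ ++ l₂) ≃ prodP l₁ ⊗ prodP l₂
prodP-++ []       l₂ = ≃-sym (ℤX.*-identityˡ (prodP l₂))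
prodP-++ (x ∷ l₁) l₂ = ≃-trans (ℤX.*-congˡ {x} (prodP-++ l₁ l₂)) (≃-sym (ℤX.*-assoc x (prodP l₁) (prodP l₂)))

prodP-concatMap : ∀ {n} {A : Set} (h : Fin n → A) (g : A → List Poly) →
                  prodP (concatMap g (tabulate h)) ≃ ∏ (prodP ∘ g ∘ h)
prodP-concatMap {zero}  h g = ≃-refl
prodP-concatMap {suc n} h g =
  ≃-trans (prodP-++ (g (h zero)) (concatMap g (tabulate (h ∘ suc))))
          (ℤX.*-congˡ {prodP (g (h zero))} (prodP-concatMap (h ∘ suc) g))

prodP-map : ∀ {n} {A : Set} (h : Fin n → A) (f : A → Poly) → prodP (map f (tabulate h)) ≃ ∏ (f ∘ h)
prodP-map {zero}  h f = ≃-refl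
prodP-map {suc n} h f = ℤX.*-congˡ {f (h zero)} (prodP-map (h ∘ suc) f)

sumP-map : ∀ {n} {A : Set} (h : Fin n → A) (f : A → Poly) → sumP (map f (tabulate h)) ≃ sum (f ∘ h)
sumP-map {zero}  h f = ≃-refl
sumP-map {suc n} h f = ℤX.+-congˡ {f (h zero)} (sumP-map (h ∘ suc) f)

prodP-if : ∀ b x → prodP (if b then x ∷ [] else []) ≃ (if b then x else oneP)
prodP-if false x = ≃-refl
prodP-if true  x = ℤX.*-identityʳ x

ExactlyOne : Bool → Bool → Set
ExactlyOne s s′ = (s ≡ true × s′ ≡ false) ⊎ (s ≡ false × s′ ≡ true)

+-right-comm : ∀ x y z → x + y + z ≡ x + z + y
+-right-comm x y z = trans (ℕ.+-assoc x y z) (trans (cong (x +_) (ℕ.+-comm y z)) (sym (ℕ.+-assoc x z y)))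

if-∧-merge : ∀ c s s′ (x y : Poly) → (c ≡ true → ExactlyOne s s′) →
  (if c ∧ s then x else oneP) ⊗ (if c ∧ s′ then y else oneP) ≃ (if c then (if s then x else y) else oneP)
if-∧-merge false s s′ x y _ = ℤX.*-identityˡ oneP
if-∧-merge true  s s′ x y one with one refl
... | inj₁ (refl , refl) = ℤX.*-identityʳ x
... | inj₂ (refl , refl) = ℤX.*-identityˡ y

module Factors {n} (p : Fin n → ℕ) (S : Fin n → Fin n → Bool) where

  d : Fin n → Poly
  d j = 1-X^ (N₁ p j)

  E : Fin n → Fin n → Poly
  E j₁ j₂ = 1-X^ (N₂ p j₁ j₂)

  exponent : Fin n → Fin n → ℕ
  exponent i j = invMod (p i) (p j) * N₁ p j

  F : Fin n → Fin n → Poly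
  F i j = if S i j then 1-X^ (exponent i j) else X^ (NN p) ⊕ negP (X^ (exponent i j))

  pairsProd≃∏-pairs : ∀ allowed → pairsProd p allowed ≃ ∏-pairs allowed E
  pairsProd≃∏-pairs allowed =
    ≃-trans (prodP-concatMap id row)
            (∏-cong λ j₁ → ≃-trans (prodP-concatMap id (cell j₁)) (∏-cong λ j₂ → prodP-if (guard j₁ j₂) (E j₁ j₂)))
    where
    guard : Fin n → Fin n → Bool
    guard j₁ j₂ = allowed j₁ ∧ allowed j₂ ∧ (toℕ j₁ <ᵇ toℕ j₂)
    cell : Fin n → Fin n → List Poly
    cell j₁ j₂ = if guard j₁ j₂ then E j₁ j₂ ∷ [] else []
    row : Fin n → List Poly
    row j₁ = concatMap (cell j₁) (allFin n)

  numP≃ : numP p ≃ 1-X^ (NN p) ⊗ ∏-pairs (λ _ → true) E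
  numP≃ = ℤX.*-congˡ {1-X^ (NN p)} (pairsProd≃∏-pairs (λ _ → true))

  denP≃ : denP p ≃ ∏ d
  denP≃ = prodP-map id d

  module _ (S-tournament : ∀ i j → i ≢ j → ExactlyOne (S i j) (S j i)) where

    termA≃ : ∀ i → termA p S i ≃ 1-X^ (NN p) ⊗ sourceTerm E F i
    termA≃ i = begin
      1-X^ (NN p) ⊗ Xᵢ ⊗ Yᵢ ⊗ pairsProd p (distinct i)
        ≈⟨ solveℤ[X] 4 (λ t x y z → t :* x :* y :* z := t :* (x :* y :* z)) ≃-refl (1-X^ (NN p)) Xᵢ Yᵢ _ ⟩
      1-X^ (NN p) ⊗ (Xᵢ ⊗ Yᵢ ⊗ pairsProd p (distinct i))
        ≈⟨ ℤX.*-congˡ {1-X^ (NN p)} (ℤX.*-cong XᵢYᵢ≃ (pairsProd≃∏-pairs (distinct i))) ⟩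
      1-X^ (NN p) ⊗ sourceTerm E F i ∎
      where
      open ≃-Reasoning
      A B : Fin n → Poly
      A j = 1-X^ (exponent i j)
      B j = X^ (NN p) ⊕ negP (X^ (exponent i j))
      Aᵢ Bᵢ : Fin n → List Poly
      Aᵢ j = if distinct i j ∧ S i j then A j ∷ [] else []
      Bᵢ j = if distinct i j ∧ S j i then B j ∷ [] else []
      Xᵢ = prodP (concatMap Aᵢ (allFin n))
      Yᵢ = prodP (concatMap Bᵢ (allFin n))
      XᵢYᵢ≃ : Xᵢ ⊗ Yᵢ ≃ ∏-except i (F i)
      XᵢYᵢ≃ = begin
        Xᵢ ⊗ Yᵢ
          ≈⟨ ℤX.*-cong (≃-trans (prodP-concatMap id Aᵢ) (∏-cong λ j → prodP-if (distinct i j ∧ S i j) (A j)))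
                       (≃-trans (prodP-concatMap id Bᵢ) (∏-cong λ j → prodP-if (distinct i j ∧ S j i) (B j))) ⟩
        ∏ (λ j → if distinct i j ∧ S i j then A j else oneP) ⊗ ∏ (λ j → if distinct i j ∧ S j i then B j else oneP)
          ≈⟨ ∏-distrib-* (λ j → if distinct i j ∧ S i j then A j else oneP) (λ j → if distinct i j ∧ S j i then B j else oneP) ⟨
        ∏ (λ j → (if distinct i j ∧ S i j then A j else oneP) ⊗ (if distinct i j ∧ S j i then B j else oneP))
          ≈⟨ ∏-cong (λ j → if-∧-merge (distinct i j) (S i j) (S j i) (A j) (B j) (S-tournament i j ∘ distinct⇒≢ i j)) ⟩
        ∏-except i (F i) ∎

    rhsTimesDen≃ : rhsTimesDen p S ≃ 1-X^ (NN p) ⊗ sum (sourceTerm E F)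
    rhsTimesDen≃ = ≃-trans (sumP-map id (termA p S))
                   (≃-trans (sum-cong termA≃) (≃-sym (*-distribˡ-sum (1-X^ (NN p)) (sourceTerm E F))))

  module _ (p-prime : ∀ i → Prime (p i)) (p-injective : ∀ i j → p i ≡ p j → i ≡ j) where

    p-distinct : ∀ {i j} → i ≢ j → p i ≢ p j
    p-distinct i≢j = i≢j ∘ p-injective _ _

    d∣F : ∀ i j → i ≢ j → d j ∣ F i j
    d∣F i j i≢j with S i j
    ... | true  = 1-X^-∣-1-X^-* (invMod (p i) (p j)) (N₁ p j)
    ... | false = subst (λ N → d j ∣ X^ N ⊕ negP (X^ (exponent i j))) (sym N≡) (1-X^-∣-X^-X^ (exponent i j) (p j ∸ c) (N₁ p j))
      where
      c = invMod (p i) (p j)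
      c<pⱼ = proj₁ (invMod-inverse (prime⇒1< (p-prime j)) (primes-coprime (p-prime i) (p-prime j) (p-distinct i≢j)))
      N≡ : NN p ≡ c * N₁ p j + (p j ∸ c) * N₁ p j
      N≡ = begin
        NN p                                ≡⟨ NN≡N₁*p p j (ℕ.<-trans (s≤s z≤n) (prime⇒1< (p-prime j))) ⟩
        N₁ p j * p j                        ≡⟨ ℕ.*-comm (N₁ p j) (p j) ⟩
        p j * N₁ p j                        ≡⟨ cong (_* N₁ p j) (ℕ.m+[n∸m]≡n (ℕ.<⇒≤ c<pⱼ)) ⟨
        (c + (p j ∸ c)) * N₁ p j            ≡⟨ ℕ.*-distribʳ-+ (N₁ p j) c (p j ∸ c) ⟩
        c * N₁ p j + (p j ∸ c) * N₁ p j     ∎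
        where open ≡-Reasoning

    E≡F+F : (∀ i j → i ≢ j → ExactlyOne (S i j) (S j i)) →
            ∀ i j → toℕ i < toℕ j → E i j ≡ F i j ⊕ F j i [mod d i ⊗ d j ]
    E≡F+F S-tournament i j i<j =
      mod-trans (≈⇒≡mod (≡⇒≃ (cong 1-X^ N₂≡M))) (mod-sym (oriented (S-tournament i j i≢j)))
      where
      i≢j : i ≢ j
      i≢j i≡j = ℕ.<-irrefl (cong toℕ i≡j) i<j
      open PairExponents (pairExponents p i j (p-prime i) (p-prime j) (p-distinct i≢j))
      oriented : ExactlyOne (S i j) (S j i) → F i j ⊕ F j i ≡ 1-X^ M [mod d i ⊗ d j ]
      oriented (inj₁ (Sij , Sji)) rewrite Sij | Sji = pair-congruence t s (N₁ p i) (N₁ p j) cNⱼ≡ c′Nᵢ≡ NN≡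
      oriented (inj₂ (Sij , Sji)) rewrite Sij | Sji =
        mod-trans (≈⇒≡mod (ℤX.+-comm (X^ (NN p) ⊕ negP (X^ (exponent i j))) (1-X^ (exponent j i))))
                  (mod-resp-≈ (ℤX.*-comm (d j) (d i))
                              (pair-congruence s t (N₁ p j) (N₁ p i) c′Nᵢ≡ cNⱼ≡ (trans NN≡ (+-right-comm M _ _))))

mainTheorem6 : (n : ℕ) → 2 ≤ n →
    (p : Fin n → ℕ) → (∀ i → Prime (p i)) → (∀ i j → p i ≡ p j → i ≡ j) →
    (S : Fin n → Fin n → Bool) →
    (∀ i j → i ≢ j → (S i j ≡ true × S j i ≡ false) ⊎ (S i j ≡ false × S j i ≡ true)) →
    ∃ λ (R : Poly) →
      numP p ≈ₚ rhsTimesDen p S ⊕ 1-X^ (NN p) ⊗ R ⊗ denP p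
mainTheorem6 n _ p p-prime p-injective S S-tournament with
  ∏-pairs≡∑sourceTerm d E F (d∣F p-prime p-injective) (E≡F+F p-prime p-injective S-tournament)
  where open Factors p S
... | W , T≃Σ+WD = W , coeff-≡ (begin
  numP p                                     ≈⟨ numP≃ ⟩
  1-X^ N ⊗ ∏-pairs (λ _ → true) E            ≈⟨ ℤX.*-congˡ {1-X^ N} T≃Σ+WD ⟩
  1-X^ N ⊗ (sum (sourceTerm E F) ⊕ W ⊗ ∏ d)
    ≈⟨ solveℤ[X] 4 (λ t s w d → t :* (s :+ w :* d) := t :* s :+ t :* w :* d) ≃-refl (1-X^ N) _ W (∏ d) ⟩
  1-X^ N ⊗ sum (sourceTerm E F) ⊕ 1-X^ N ⊗ W ⊗ ∏ d
    ≈⟨ ℤX.+-cong (rhsTimesDen≃ S-tournament) (ℤX.*-congˡ {1-X^ N ⊗ W} denP≃) ⟨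
  rhsTimesDen p S ⊕ 1-X^ N ⊗ W ⊗ denP p      ∎)
  where
  open Factors p S
  open ≃-Reasoning
  N = NN p
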